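{- Let $q$ be a power of an odd prime with $q\equiv 3\pmod 4$. Let $a\in\mathbb{F}_q$ and let $u,u'$ be nonzero squares in $\mathbb{F}_q$ with $u+u'=a^2$, and let $\epsilon\in\{\pm1\}$. Then $\eta(a+\sqrt{u})=\eta(a-\sqrt{u})=\epsilon$ if and only if $\eta(a+\sqrt{u'})=\eta(a-\sqrt{u'})=\eta(2)\epsilon$.
   Context: $\eta$ is the quadratic character of $\mathbb{F}_q$ ($\eta(0)=0$, $\eta=1$ on nonzero squares, $-1$ on non-squares). For a nonzero square $s$, $\pm\sqrt{s}$ denote its two square roots in $\mathbb{F}_q$. -}

module Defs where

open import Level using (Level; _⊔_)
open import Algebra.Bundles using (CommutativeRing)
open import Data.Nat using (ℕ)
open import Data.Fin using (Fin)
open import Data.Fin.Properties as FinP using (any?)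
open import Data.Integer using (ℤ; +_; -[1+_])
open import Data.Product using (Σ; ∃; _,_; _×_)
open import Relation.Nullary using (¬_; Dec; yes; no)
open import Relation.Binary.PropositionalEquality as ≡ using (_≡_)
open import Function.Bundles using (Inverse)

record IsField {c ℓ : Level} (F : CommutativeRing c ℓ) : Set (c ⊔ ℓ) where
  open CommutativeRing F
  field
    1≉0     : ¬ (1# ≈ 0#)
    inverse : ∀ x → ¬ (x ≈ 0#) → ∃ λ y → (x * y) ≈ 1#

record FiniteField (c ℓ : Level) (q : ℕ) : Set (Level.suc (c ⊔ ℓ)) where
  field
    commRing : CommutativeRing c ℓ
    isField : IsField commRing
    enum    : Inverse (CommutativeRing.setoid commRing) (≡.setoid (Fin q))
  open CommutativeRing commRing public hiding (ring)
  open Inverse enum public using (to; from)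

  _≈?_ : ∀ x y → Dec (x ≈ y)
  x ≈? y with to x FinP.≟ to y
  ... | yes eq = yes (trans (sym (Inverse.strictlyInverseʳ enum x))
                     (trans (Inverse.from-cong enum eq) (Inverse.strictlyInverseʳ enum y)))
  ... | no ne = no λ e → ne (Inverse.to-cong enum e)

  IsSquare : Carrier → Set (c ⊔ ℓ)
  IsSquare x = ∃ λ y → (y * y) ≈ x

  isSquare? : ∀ x → Dec (∃ λ (i : Fin q) → (from i * from i) ≈ x)
  isSquare? x = any? (λ i → (from i * from i) ≈? x)

  η : Carrier → ℤ
  η x with x ≈? 0#
  ... | yes _ = + 0
  ... | no _ with isSquare? x
  ...   | yes _ = + 1
  ...   | no _  = -[1+ 0 ]

  two : Carrier
  two = 1# + 1#

-- Write s for r′. From a² = r² + s² one gets (a + r)(a − r) = s² and (a + r + s)² = 2(a + r)(a + s).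
-- As η takes the same value on x and y whenever x y is a nonzero square, the first identity gives
-- η(a + r) = η(a − r), and the second, with multiplicativity of η, gives η(a + s) = η(2) η(a + r). Then x ↦ −x pairs off F*, and squaring one element of each pair shows that
-- there are at least as many nonzero squares as nonsquares; if a product n m of nonsquares were a
-- nonsquare, x ↦ n x would inject the nonzero squares into the nonsquares other than n m. Hence η is
-- multiplicative on F*.

module Submission where

open import Defs
open import Level using (Level; _⊔_)
open import Algebra.Bundles using (CommutativeSemiring; CommutativeRing)
open import Data.Empty using (⊥-elim)
open import Data.Fin using (Fin; zero; suc; _<_)
open import Data.Fin.Properties using (_≟_; suc-injective; 0≢1+n; _<?_; <-asym; <-cmp)
import Data.Integer as ℤ
import Data.Integer.Properties as ℤₚ
open import Data.Nat as ℕ using (ℕ; _%_; _≤_)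
import Data.Nat.Properties as ℕₚ
open import Data.Nat.DivMod using (m*n%n≡0; m∣n⇒o%n%m≡o%m)
open import Data.Nat.Divisibility using (divides)
open import Data.Product using (∃; _×_; _,_; proj₁)
open import Function using (_∘_)
open import Function.Bundles using (Inverse; mk⇔)
open import Relation.Binary.Definitions using (_Respects_)
open import Relation.Binary.PropositionalEquality as ≡ using (_≡_; _≢_)
open import Relation.Nullary using (¬_; Dec; yes; no; contradiction)
open import Relation.Nullary.Decidable using (map′)
open import Relation.Unary using (Pred; Decidable; _∩_; ∁; _≐_)
open import Relation.Unary.Properties using (_∩?_; ∁?; U?)

module Counting where
  open import Data.Nat using (zero; suc; _+_; _*_; z≤n; s≤s)
  open ≡ using (refl; sym; trans; cong; subst; module ≡-Reasoning)
  open import Relation.Binary using (tri<; tri≈; tri>)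

  private variable
    m n : ℕ
    p r : Level

  count : {P : Pred (Fin n) p} → Decidable P → ℕ
  count {zero}  P? = 0
  count {suc n} P? with P? zero
  ... | yes _ = suc (count (P? ∘ suc))
  ... | no _  = count (P? ∘ suc)

  count-U : count (U? {A = Fin n}) ≡ n
  count-U {zero}  = refl
  count-U {suc n} = cong suc count-U

  count-cong : {P Q : Pred (Fin n) p} (P? : Decidable P) (Q? : Decidable Q) →
               P ≐ Q → count P? ≡ count Q?
  count-cong {zero}  P? Q? P≐Q = refl
  count-cong {suc n} P? Q? (P⊆Q , Q⊆P) with P? zero | Q? zero
  ... | yes _  | yes _  = cong suc (count-cong (P? ∘ suc) (Q? ∘ suc) (P⊆Q , Q⊆P))
  ... | yes p₀ | no ¬q₀ = contradiction (P⊆Q p₀) ¬q₀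
  ... | no ¬p₀ | yes q₀ = contradiction (Q⊆P q₀) ¬p₀
  ... | no _   | no _   = count-cong (P? ∘ suc) (Q? ∘ suc) (P⊆Q , Q⊆P)

  count-∩-∁ : {P : Pred (Fin n) p} {Q : Pred (Fin n) r} (P? : Decidable P) (Q? : Decidable Q) →
              count P? ≡ count (P? ∩? Q?) + count (P? ∩? ∁? Q?)
  count-∩-∁ {zero}  P? Q? = refl
  count-∩-∁ {suc n} P? Q? with P? zero | Q? zero
  ... | yes _ | yes _ = cong suc (count-∩-∁ (P? ∘ suc) (Q? ∘ suc))
  ... | yes _ | no _  = trans (cong suc (count-∩-∁ (P? ∘ suc) (Q? ∘ suc))) (sym (ℕₚ.+-suc _ _))
  ... | no _  | _     = count-∩-∁ (P? ∘ suc) (Q? ∘ suc)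

  private
    count-∁≡-suc : {P : Pred (Fin (suc n)) p} (P? : Decidable P) (k : Fin n) →
                   count ((P? ∘ suc) ∩? ∁? (_≟ k)) ≡ count ((P? ∩? ∁? (_≟ suc k)) ∘ suc)
    count-∁≡-suc P? k = count-cong ((P? ∘ suc) ∩? ∁? (_≟ k)) ((P? ∩? ∁? (_≟ suc k)) ∘ suc)
      ((λ (pi , i≢k) → pi , i≢k ∘ suc-injective) , λ (pi , si≢sk) → pi , si≢sk ∘ cong suc)

  count-remove : {P : Pred (Fin n) p} (P? : Decidable P) (k : Fin n) → P k →
                 count P? ≡ suc (count (P? ∩? ∁? (_≟ k)))
  count-remove {suc n} P? zero pk with P? zero
  ... | yes _  = cong suc (count-cong (P? ∘ suc) _ ((λ pi → pi , λ ()) , proj₁))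
  ... | no ¬pk = contradiction pk ¬pk
  count-remove {suc n} P? (suc k) pk with P? zero
  ... | yes _ = cong suc (trans (count-remove (P? ∘ suc) k pk) (cong suc (count-∁≡-suc P? k)))
  ... | no _  = trans (count-remove (P? ∘ suc) k pk) (cong suc (count-∁≡-suc P? k))

  count-mono-injective : {P : Pred (Fin m) p} {Q : Pred (Fin n) r}
                         (P? : Decidable P) (Q? : Decidable Q) (f : Fin m → Fin n) →
                         (∀ {i} → P i → Q (f i)) →
                         (∀ {i j} → P i → P j → f i ≡ f j → i ≡ j) →
                         count P? ≤ count Q?
  count-mono-injective {zero}  P? Q? f P⇒Qf inj = z≤n
  count-mono-injective {suc m} P? Q? f P⇒Qf inj with P? zero
  ... | no _   = count-mono-injective (P? ∘ suc) Q? (f ∘ suc) P⇒Qf (λ pi pj → suc-injective ∘ inj pi pj)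
  ... | yes p₀ = begin
    suc (count (P? ∘ suc))                  ≤⟨ s≤s (count-mono-injective (P? ∘ suc) (Q? ∩? ∁? (_≟ f zero)) (f ∘ suc)
                                                 (λ pi → P⇒Qf pi , λ fi≡f₀ → 0≢1+n (inj p₀ pi (sym fi≡f₀)))
                                                 (λ pi pj → suc-injective ∘ inj pi pj)) ⟩
    suc (count (Q? ∩? ∁? (_≟ f zero)))      ≡⟨ count-remove Q? (f zero) (P⇒Qf p₀) ⟨
    count Q?                                ∎
    where
    open ℕₚ.≤-Reasoning

  count-involution : {P : Pred (Fin n) p} (P? : Decidable P) (f : Fin n → Fin n) →
                     (∀ i → f (f i) ≡ i) → (∀ {i} → P i → P (f i)) → (∀ {i} → P i → f i ≢ i) →
                     count P? ≡ 2 * count (P? ∩? λ i → i <? f i)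
  count-involution {P = P} P? f f∘f≡id P⇒Pf fixfree = begin
    count P?        ≡⟨ count-∩-∁ P? (λ i → i <? f i) ⟩
    lower + upper   ≡⟨ cong (lower +_) (ℕₚ.≤-antisym upper≤lower lower≤upper) ⟩
    lower + lower   ≡⟨ cong (lower +_) (ℕₚ.+-identityʳ lower) ⟨
    2 * lower       ∎
    where
    open ≡-Reasoning
    lower upper : ℕ
    lower = count (P? ∩? λ i → i <? f i)
    upper = count (P? ∩? ∁? λ i → i <? f i)
    f-injective : ∀ {i j} → f i ≡ f j → i ≡ j
    f-injective {i} {j} fi≡fj = trans (sym (f∘f≡id i)) (trans (cong f fi≡fj) (f∘f≡id j))
    lower≤upper : lower ≤ upper
    lower≤upper = count-mono-injective _ _ f
      (λ (pi , i<fi) → P⇒Pf pi , λ fi<ffi → <-asym i<fi (subst (f _ <_) (f∘f≡id _) fi<ffi))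
      (λ _ _ → f-injective)
    upper≤lower : upper ≤ lower
    upper≤lower = count-mono-injective _ _ f below (λ _ _ → f-injective)
      where
      below : ∀ {i} → (P ∩ ∁ (λ i → i < f i)) i → (P ∩ (λ i → i < f i)) (f i)
      below {i} (pi , i≮fi) with <-cmp i (f i)
      ... | tri< i<fi _ _ = contradiction i<fi i≮fi
      ... | tri≈ _ i≡fi _ = contradiction (sym i≡fi) (fixfree pi)
      ... | tri> _ _ fi<i = P⇒Pf pi , subst (f i <_) (sym (f∘f≡id i)) fi<i

module CommutativeSemiringIdentities {c ℓ} (S : CommutativeSemiring c ℓ) where
  open CommutativeSemiring S
  open import Algebra.Solver.Ring.NaturalCoefficients.Default S
  open import Relation.Binary.Reasoning.Setoid setoid

  square-of-sum≈2*product : ∀ a r s → a * a ≈ r * r + s * s →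
                            (a + r + s) * (a + r + s) ≈ (1# + 1#) * ((a + r) * (a + s))
  square-of-sum≈2*product a r s a²≈r²+s² = begin
    (a + r + s) * (a + r + s)              ≈⟨ solve 3 (λ a r s → (a :+ r :+ s) :* (a :+ r :+ s)
                                                  := (r :* r :+ s :* s) :+ (a :* (a :+ con 2 :* (r :+ s)) :+ con 2 :* r :* s)) refl a r s ⟩
    (r * r + s * s) + rest                 ≈⟨ +-congʳ a²≈r²+s² ⟨
    a * a + rest                           ≈⟨ solve 3 (λ a r s → a :* a :+ (a :* (a :+ con 2 :* (r :+ s)) :+ con 2 :* r :* s)
                                                  := con 2 :* ((a :+ r) :* (a :+ s))) refl a r s ⟩
    (1# + 1#) * ((a + r) * (a + s))        ∎
    where
    rest : Carrier
    rest = a * (a + (1# + 1#) * (r + s)) + (1# + 1#) * r * s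

module CommutativeRingIdentities {c ℓ} (R : CommutativeRing c ℓ) where
  open CommutativeRing R
  open import Algebra.Properties.Ring ring using (x[y-z]≈xy-xz; xyx⁻¹≈y)
  open import Relation.Binary.Reasoning.Setoid setoid

  [x-y]+[y-z]≈x-z : ∀ x y z → (x - y) + (y - z) ≈ x - z
  [x-y]+[y-z]≈x-z x y z = begin
    (x - y) + (y - z)   ≈⟨ +-assoc x (- y) (y - z) ⟩
    x + (- y + (y - z)) ≈⟨ +-congˡ (+-assoc (- y) y (- z)) ⟨
    x + ((- y + y) - z) ≈⟨ +-congˡ (+-congʳ (-‿inverseˡ y)) ⟩
    x + (0# - z)        ≈⟨ +-congˡ (+-identityˡ (- z)) ⟩
    x - z               ∎

  [x+y][x-y]≈x²-y² : ∀ x y → (x + y) * (x - y) ≈ x * x - y * y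
  [x+y][x-y]≈x²-y² x y = begin
    (x + y) * (x - y)                  ≈⟨ distribʳ (x - y) x y ⟩
    x * (x - y) + y * (x - y)          ≈⟨ +-cong (x[y-z]≈xy-xz x x y) (x[y-z]≈xy-xz y x y) ⟩
    (x * x - x * y) + (y * x - y * y)  ≈⟨ +-congˡ (+-congʳ (*-comm y x)) ⟩
    (x * x - x * y) + (x * y - y * y)  ≈⟨ [x-y]+[y-z]≈x-z (x * x) (x * y) (y * y) ⟩
    x * x - y * y                      ∎

  [a+r][a-r]≈s² : ∀ a r s → a * a ≈ r * r + s * s → (a + r) * (a - r) ≈ s * s
  [a+r][a-r]≈s² a r s a²≈r²+s² = begin
    (a + r) * (a - r)          ≈⟨ [x+y][x-y]≈x²-y² a r ⟩
    a * a - r * r              ≈⟨ +-congʳ a²≈r²+s² ⟩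
    r * r + s * s - r * r      ≈⟨ xyx⁻¹≈y (r * r) (s * s) ⟩
    s * s                      ∎

module FieldProperties {c ℓ} (R : CommutativeRing c ℓ) (R-isField : IsField R) where
  open CommutativeRing R
  open IsField R-isField
  open CommutativeRingIdentities R using ([x+y][x-y]≈x²-y²)
  open import Algebra.Properties.Ring ring using (x[y-z]≈xy-xz; x∙y⁻¹≈ε⇒x≈y; x≈y⇒x∙y⁻¹≈ε; +-inverseˡ-unique)
  open import Algebra.Solver.Ring.NaturalCoefficients.Default commutativeSemiring
  open import Relation.Binary.Reasoning.Setoid setoid

  private variable
    x y z : Carrier

  x≉0⇒x*y≈0⇒y≈0 : ¬ x ≈ 0# → x * y ≈ 0# → y ≈ 0#
  x≉0⇒x*y≈0⇒y≈0 {x} {y} x≉0 xy≈0 with inverse x x≉0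
  ... | x⁻¹ , xx⁻¹≈1 = begin
    y               ≈⟨ *-identityˡ y ⟨
    1# * y          ≈⟨ *-congʳ xx⁻¹≈1 ⟨
    (x * x⁻¹) * y   ≈⟨ solve 3 (λ x x⁻¹ y → (x :* x⁻¹) :* y := x⁻¹ :* (x :* y)) refl x x⁻¹ y ⟩
    x⁻¹ * (x * y)   ≈⟨ *-congˡ xy≈0 ⟩
    x⁻¹ * 0#        ≈⟨ zeroʳ x⁻¹ ⟩
    0#              ∎

  *-nonzero : ¬ x ≈ 0# → ¬ y ≈ 0# → ¬ x * y ≈ 0#
  *-nonzero x≉0 y≉0 = y≉0 ∘ x≉0⇒x*y≈0⇒y≈0 x≉0

  x*y≉0⇒x≉0 : ¬ x * y ≈ 0# → ¬ x ≈ 0#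
  x*y≉0⇒x≉0 {x} {y} xy≉0 x≈0 = xy≉0 (trans (*-congʳ x≈0) (zeroˡ y))

  x*y≉0⇒y≉0 : ¬ x * y ≈ 0# → ¬ y ≈ 0#
  x*y≉0⇒y≉0 {x} {y} xy≉0 y≈0 = xy≉0 (trans (*-congˡ y≈0) (zeroʳ x))

  *-cancelˡ-nonzero : ¬ x ≈ 0# → x * y ≈ x * z → y ≈ z
  *-cancelˡ-nonzero {x} {y} {z} x≉0 xy≈xz = x∙y⁻¹≈ε⇒x≈y y z
    (x≉0⇒x*y≈0⇒y≈0 x≉0 (trans (x[y-z]≈xy-xz x y z) (x≈y⇒x∙y⁻¹≈ε xy≈xz)))

  x²≈y²⇒x≈-y : x * x ≈ y * y → ¬ x ≈ y → x ≈ - y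
  x²≈y²⇒x≈-y {x} {y} x²≈y² x≉y = +-inverseˡ-unique x y
    (x≉0⇒x*y≈0⇒y≈0 (x≉y ∘ x∙y⁻¹≈ε⇒x≈y x y)
      (trans (*-comm (x - y) (x + y)) (trans ([x+y][x-y]≈x²-y² x y) (x≈y⇒x∙y⁻¹≈ε x²≈y²))))

  -x≉x : ¬ (1# + 1#) ≈ 0# → ¬ x ≈ 0# → ¬ - x ≈ x
  -x≉x {x} two≉0 x≉0 -x≈x = *-nonzero two≉0 x≉0 (begin
    (1# + 1#) * x   ≈⟨ solve 1 (λ x → con 2 :* x := x :+ x) refl x ⟩
    x + x           ≈⟨ +-congˡ -x≈x ⟨
    x - x           ≈⟨ -‿inverseʳ x ⟩
    0#              ∎)

  root-nonzero : x * x ≈ y → ¬ y ≈ 0# → ¬ x ≈ 0#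
  root-nonzero x²≈y y≉0 = x*y≉0⇒x≉0 (y≉0 ∘ trans (sym x²≈y))

  IsSquare : Carrier → Set (c ⊔ ℓ)
  IsSquare x = ∃ λ y → y * y ≈ x

  square-resp-≈ : x ≈ y → IsSquare x → IsSquare y
  square-resp-≈ x≈y (t , t²≈x) = t , trans t²≈x x≈y

  square-* : IsSquare x → IsSquare y → IsSquare (x * y)
  square-* {x} {y} (s , s²≈x) (t , t²≈y) = s * t , (begin
    (s * t) * (s * t) ≈⟨ solve 2 (λ s t → (s :* t) :* (s :* t) := (s :* s) :* (t :* t)) refl s t ⟩
    (s * s) * (t * t) ≈⟨ *-cong s²≈x t²≈y ⟩
    x * y             ∎)

  square-÷ : ¬ y ≈ 0# → IsSquare y → IsSquare (x * y) → IsSquare x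
  square-÷ {y} {x} y≉0 (t , t²≈y) (s , s²≈xy) with inverse t (root-nonzero t²≈y y≉0)
  ... | t⁻¹ , tt⁻¹≈1 = s * t⁻¹ , (begin
    (s * t⁻¹) * (s * t⁻¹)         ≈⟨ solve 2 (λ s u → (s :* u) :* (s :* u) := (s :* s) :* (u :* u)) refl s t⁻¹ ⟩
    (s * s) * (t⁻¹ * t⁻¹)         ≈⟨ *-congʳ (trans s²≈xy (*-congˡ (sym t²≈y))) ⟩
    (x * (t * t)) * (t⁻¹ * t⁻¹)   ≈⟨ solve 3 (λ x t u → (x :* (t :* t)) :* (u :* u) := x :* ((t :* u) :* (t :* u))) refl x t t⁻¹ ⟩
    x * ((t * t⁻¹) * (t * t⁻¹))   ≈⟨ *-congˡ (*-cong tt⁻¹≈1 tt⁻¹≈1) ⟩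
    x * (1# * 1#)                 ≈⟨ *-congˡ (*-identityˡ 1#) ⟩
    x * 1#                        ≈⟨ *-identityʳ x ⟩
    x                             ∎)

module FiniteFieldProperties {c ℓ q} (F : FiniteField c ℓ q) where
  open FiniteField F
  open IsField isField
  open FieldProperties commRing isField hiding (IsSquare)
  open CommutativeRingIdentities commRing using ([a+r][a-r]≈s²)
  open CommutativeSemiringIdentities commutativeSemiring using (square-of-sum≈2*product)
  open Counting
  open Inverse enum using (from-cong; inverseˡ; strictlyInverseˡ; strictlyInverseʳ)
  open import Algebra.Definitions _≈_ using (Congruent₁; Involutive)
  open import Algebra.Properties.Ring (CommutativeRing.ring commRing) using (-‿involutive; -‿injective; -0#≈0#; +-cancelˡ)

  private variable
    p : Level
    x y : Carrier
    i j : Fin q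

  from-injective : from i ≈ from j → i ≡ j
  from-injective {i} e = ≡.trans (≡.sym (strictlyInverseˡ i)) (inverseˡ e)

  to-injective : to x ≡ to y → x ≈ y
  to-injective {x} {y} e = trans (sym (strictlyInverseʳ x)) (trans (from-cong e) (strictlyInverseʳ y))

  index-map : (Carrier → Carrier) → Fin q → Fin q
  index-map g i = to (g (from i))

  from-index-map : ∀ g i → from (index-map g i) ≈ g (from i)
  from-index-map g i = strictlyInverseʳ (g (from i))

  count-involution-on-carrier :
    {P : Pred Carrier p} (P? : Decidable P) (g : Carrier → Carrier) →
    Congruent₁ g → Involutive g → P Respects _≈_ →
    (∀ {x} → P x → P (g x)) → (∀ {x} → P x → ¬ g x ≈ x) →
    count (P? ∘ from) ≡ 2 ℕ.* count ((P? ∘ from) ∩? λ i → i <? index-map g i)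
  count-involution-on-carrier P? g g-cong g-involutive P-resp P⇒Pg fixfree =
    count-involution (P? ∘ from) (index-map g)
      (λ i → inverseˡ (trans (from-cong-g i) (g-involutive (from i))))
      (λ {i} pi → P-resp (sym (from-index-map g i)) (P⇒Pg pi))
      (λ {i} pi gi≡i → fixfree pi (trans (sym (from-index-map g i)) (from-cong gi≡i)))
    where
    from-cong-g : ∀ i → g (from (index-map g i)) ≈ g (g (from i))
    from-cong-g i = g-cong (from-index-map g i)

  odd-order⇒two≉0 : q % 2 ≡ 1 → ¬ two ≈ 0#
  odd-order⇒two≉0 q-odd two≈0 = ℕₚ.0≢1+n (≡.trans (≡.sym q%2≡0) q-odd)
    where
    +1-involutive : Involutive (_+ 1#)
    +1-involutive x = trans (+-assoc x 1# 1#) (trans (+-congˡ two≈0) (+-identityʳ x))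
    x+1≉x : ∀ {x} → ¬ x + 1# ≈ x
    x+1≉x {x} x+1≈x = 1≉0 (+-cancelˡ x 1# 0# (trans x+1≈x (sym (+-identityʳ x))))
    half : ℕ
    half = count ((U? ∘ from) ∩? λ i → i <? index-map (_+ 1#) i)
    q≡2*half : q ≡ 2 ℕ.* half
    q≡2*half = ≡.trans (≡.sym count-U)
      (count-involution-on-carrier U? (_+ 1#) +-congʳ +1-involutive _ _ (λ _ → x+1≉x))
    q%2≡0 : q % 2 ≡ 0
    q%2≡0 = ≡.trans (≡.cong (_% 2) (≡.trans q≡2*half (ℕₚ.*-comm 2 half))) (m*n%n≡0 half 2)

  indexed-square : IsSquare x → ∃ λ j → from j * from j ≈ x
  indexed-square (t , t²≈x) = to t , trans (*-cong (strictlyInverseʳ t) (strictlyInverseʳ t)) t²≈x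

  square? : Decidable IsSquare
  square? x = map′ (λ (j , p) → from j , p) indexed-square (isSquare? x)

  nonzero? : Decidable (λ x → ¬ x ≈ 0#)
  nonzero? = ∁? (_≈? 0#)

  nonzero-square? : Decidable (λ x → ¬ x ≈ 0# × IsSquare x)
  nonzero-square? = nonzero? ∩? square?

  nonsquare? : Decidable (λ x → ¬ x ≈ 0# × ¬ IsSquare x)
  nonsquare? = nonzero? ∩? ∁? square?

  count-below-negation≤count-squares :
    count ((nonzero? ∘ from) ∩? λ i → i <? index-map -_ i) ≤ count (nonzero-square? ∘ from)
  count-below-negation≤count-squares = count-mono-injective _ _ (index-map square)
    (λ {i} (x≉0 , _) → *-nonzero x≉0 x≉0 ∘ trans (sym (from-index-map square i)) , from i , sym (from-index-map square i))
    injective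
    where
    square : Carrier → Carrier
    square x = x * x
    injective : ∀ {i j} → ¬ from i ≈ 0# × i < index-map -_ i → ¬ from j ≈ 0# × j < index-map -_ j →
                index-map square i ≡ index-map square j → i ≡ j
    injective {i} {j} (_ , i<-i) (_ , j<-j) e with i ≟ j
    ... | yes i≡j = i≡j
    ... | no i≢j = ⊥-elim (<-asym (≡.subst (i <_) -i≡j i<-i) (≡.subst (j <_) -j≡i j<-j))
      where
      x≈-y : from i ≈ - from j
      x≈-y = x²≈y²⇒x≈-y (to-injective e) (i≢j ∘ from-injective)
      -i≡j : index-map -_ i ≡ j
      -i≡j = inverseˡ (trans (-‿cong x≈-y) (-‿involutive (from j)))
      -j≡i : index-map -_ j ≡ i
      -j≡i = inverseˡ (sym x≈-y)

  count-nonsquares≤count-squares : ¬ two ≈ 0# → count (nonsquare? ∘ from) ≤ count (nonzero-square? ∘ from)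
  count-nonsquares≤count-squares two≉0 = ℕₚ.+-cancelʳ-≤ squares nonsquares squares (begin
    nonsquares ℕ.+ squares   ≡⟨ ℕₚ.+-comm nonsquares squares ⟩
    squares ℕ.+ nonsquares   ≡⟨ count-∩-∁ (nonzero? ∘ from) (square? ∘ from) ⟨
    count (nonzero? ∘ from)  ≡⟨ count-involution-on-carrier nonzero? -_ -‿cong -‿involutive
                                  (λ x≈y x≉0 → x≉0 ∘ trans x≈y) (λ x≉0 → x≉0 ∘ -x≈0⇒x≈0) (-x≉x two≉0) ⟩
    2 ℕ.* half               ≤⟨ ℕₚ.*-monoʳ-≤ 2 count-below-negation≤count-squares ⟩
    2 ℕ.* squares            ≡⟨ ≡.cong (squares ℕ.+_) (ℕₚ.+-identityʳ squares) ⟩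
    squares ℕ.+ squares      ∎)
    where
    open ℕₚ.≤-Reasoning
    squares nonsquares half : ℕ
    squares = count (nonzero-square? ∘ from)
    nonsquares = count (nonsquare? ∘ from)
    half = count ((nonzero? ∘ from) ∩? λ i → i <? index-map -_ i)
    -x≈0⇒x≈0 : - x ≈ 0# → x ≈ 0#
    -x≈0⇒x≈0 -x≈0 = -‿injective (trans -x≈0 (sym -0#≈0#))

  nonsquare*nonsquare : ¬ two ≈ 0# → ¬ x ≈ 0# → ¬ IsSquare x → ¬ y ≈ 0# → ¬ IsSquare y → IsSquare (x * y)
  nonsquare*nonsquare {x} {y} two≉0 x≉0 x∉□ y≉0 y∉□ with square? (x * y)
  ... | yes xy∈□ = xy∈□
  ... | no xy∉□  = contradiction (ℕₚ.≤-trans squares<nonsquares (count-nonsquares≤count-squares two≉0)) (ℕₚ.n≮n _)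
    where
    open ℕₚ.≤-Reasoning
    xy-index : Fin q
    xy-index = to (x * y)
    from-xy-index : from xy-index ≈ x * y
    from-xy-index = strictlyInverseʳ (x * y)
    x*-index : Fin q → Fin q
    x*-index = index-map (x *_)
    x*-maps : ∀ {i} → ¬ from i ≈ 0# × IsSquare (from i) →
              (¬ from (x*-index i) ≈ 0# × ¬ IsSquare (from (x*-index i))) × x*-index i ≢ xy-index
    x*-maps {i} (i≉0 , i∈□) =
      (*-nonzero x≉0 i≉0 ∘ trans (sym x*i≈) , x∉□ ∘ square-÷ i≉0 i∈□ ∘ square-resp-≈ x*i≈) ,
      λ e → y∉□ (square-resp-≈ (*-cancelˡ-nonzero x≉0 (trans (sym x*i≈) (trans (from-cong e) from-xy-index))) i∈□)
      where
      x*i≈ : from (x*-index i) ≈ x * from i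
      x*i≈ = from-index-map (x *_) i
    x*-injective : ∀ {i j} → ¬ from i ≈ 0# × IsSquare (from i) → ¬ from j ≈ 0# × IsSquare (from j) →
                   x*-index i ≡ x*-index j → i ≡ j
    x*-injective _ _ e = from-injective (*-cancelˡ-nonzero x≉0 (to-injective e))
    squares<nonsquares : ℕ.suc (count (nonzero-square? ∘ from)) ≤ count (nonsquare? ∘ from)
    squares<nonsquares = begin
      ℕ.suc (count (nonzero-square? ∘ from))
        ≤⟨ ℕ.s≤s (count-mono-injective _ _ x*-index x*-maps x*-injective) ⟩
      ℕ.suc (count ((nonsquare? ∘ from) ∩? ∁? (_≟ xy-index)))
        ≡⟨ count-remove (nonsquare? ∘ from) xy-index
             (*-nonzero x≉0 y≉0 ∘ trans (sym from-xy-index) , xy∉□ ∘ square-resp-≈ from-xy-index) ⟨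
      count (nonsquare? ∘ from)
        ∎

  η-square : ¬ x ≈ 0# → IsSquare x → η x ≡ ℤ.1ℤ
  η-square {x} x≉0 x∈□ with x ≈? 0#
  ... | yes x≈0 = contradiction x≈0 x≉0
  ... | no _ with isSquare? x
  ...   | yes _  = ≡.refl
  ...   | no x∉□ = contradiction (indexed-square x∈□) x∉□

  η-nonsquare : ¬ x ≈ 0# → ¬ IsSquare x → η x ≡ ℤ.-1ℤ
  η-nonsquare {x} x≉0 x∉□ with x ≈? 0#
  ... | yes x≈0 = contradiction x≈0 x≉0
  ... | no _ with isSquare? x
  ...   | yes (j , p) = contradiction (from j , p) x∉□
  ...   | no _        = ≡.refl

  η-nonzero : ¬ x ≈ 0# → ℤ.NonZero (η x)
  η-nonzero {x} x≉0 with x ≈? 0#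
  ... | yes x≈0 = contradiction x≈0 x≉0
  ... | no _ with isSquare? x
  ...   | yes _ = _
  ...   | no _  = _

  η-square-product : ¬ x * y ≈ 0# → IsSquare (x * y) → η x ≡ η y
  η-square-product {x} {y} xy≉0 xy∈□ = by-cases (square? x)
    where
    x≉0 : ¬ x ≈ 0#
    x≉0 = x*y≉0⇒x≉0 xy≉0
    y≉0 : ¬ y ≈ 0#
    y≉0 = x*y≉0⇒y≉0 xy≉0
    by-cases : Dec (IsSquare x) → η x ≡ η y
    by-cases (yes x∈□) = ≡.trans (η-square x≉0 x∈□)
      (≡.sym (η-square y≉0 (square-÷ x≉0 x∈□ (square-resp-≈ (*-comm x y) xy∈□))))
    by-cases (no x∉□) = ≡.trans (η-nonsquare x≉0 x∉□)
      (≡.sym (η-nonsquare y≉0 λ y∈□ → x∉□ (square-÷ y≉0 y∈□ xy∈□)))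

  η-* : ¬ two ≈ 0# → ¬ x ≈ 0# → ¬ y ≈ 0# → η (x * y) ≡ η x ℤ.* η y
  η-* {x} {y} two≉0 x≉0 y≉0 = by-cases (square? x) (square? y)
    where
    xy≉0 : ¬ x * y ≈ 0#
    xy≉0 = *-nonzero x≉0 y≉0
    by-cases : Dec (IsSquare x) → Dec (IsSquare y) → η (x * y) ≡ η x ℤ.* η y
    by-cases (yes x∈□) (yes y∈□) = ≡.trans (η-square xy≉0 (square-* x∈□ y∈□))
      (≡.sym (≡.cong₂ ℤ._*_ (η-square x≉0 x∈□) (η-square y≉0 y∈□)))
    by-cases (yes x∈□) (no y∉□) = ≡.trans (η-nonsquare xy≉0 (y∉□ ∘ square-÷ x≉0 x∈□ ∘ square-resp-≈ (*-comm x y)))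
      (≡.sym (≡.cong₂ ℤ._*_ (η-square x≉0 x∈□) (η-nonsquare y≉0 y∉□)))
    by-cases (no x∉□) (yes y∈□) = ≡.trans (η-nonsquare xy≉0 (x∉□ ∘ square-÷ y≉0 y∈□))
      (≡.sym (≡.cong₂ ℤ._*_ (η-nonsquare x≉0 x∉□) (η-square y≉0 y∈□)))
    by-cases (no x∉□) (no y∉□) = ≡.trans (η-square xy≉0 (nonsquare*nonsquare two≉0 x≉0 x∉□ y≉0 y∉□))
      (≡.sym (≡.cong₂ ℤ._*_ (η-nonsquare x≉0 x∉□) (η-nonsquare y≉0 y∉□)))

  module _ {a r s : Carrier} (a²≈r²+s² : a * a ≈ r * r + s * s) where

    private
      [a+r][a-r]≉0 : ¬ s ≈ 0# → ¬ (a + r) * (a - r) ≈ 0#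
      [a+r][a-r]≉0 s≉0 = *-nonzero s≉0 s≉0 ∘ trans (sym ([a+r][a-r]≈s² a r s a²≈r²+s²))

    η-conjugate : ¬ s ≈ 0# → η (a + r) ≡ η (a - r)
    η-conjugate s≉0 = η-square-product ([a+r][a-r]≉0 s≉0) (s , sym ([a+r][a-r]≈s² a r s a²≈r²+s²))

    η-swap : ¬ two ≈ 0# → ¬ r ≈ 0# → ¬ s ≈ 0# → η (a + s) ≡ η two ℤ.* η (a + r)
    η-swap two≉0 r≉0 s≉0 = ≡.trans (≡.sym (η-square-product 2[a+r][a+s]≉0 2[a+r][a+s]∈□)) (η-* two≉0 two≉0 a+r≉0)
      where
      a+r≉0 : ¬ a + r ≈ 0#
      a+r≉0 = x*y≉0⇒x≉0 ([a+r][a-r]≉0 s≉0)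
      a+s≉0 : ¬ a + s ≈ 0#
      a+s≉0 = x*y≉0⇒x≉0 (*-nonzero r≉0 r≉0 ∘ trans (sym ([a+r][a-r]≈s² a s r (trans a²≈r²+s² (+-comm _ _)))))
      2[a+r][a+s]≉0 : ¬ two * (a + r) * (a + s) ≈ 0#
      2[a+r][a+s]≉0 = *-nonzero (*-nonzero two≉0 a+r≉0) a+s≉0
      2[a+r][a+s]∈□ : IsSquare (two * (a + r) * (a + s))
      2[a+r][a+s]∈□ = a + r + s , trans (square-of-sum≈2*product a r s a²≈r²+s²) (sym (*-assoc two (a + r) (a + s)))


open import Data.Nat using (_^_; _≥_)
open import Data.Nat.Primality using (Prime)
open import Data.Integer using (ℤ; _*_; +_; -[1+_])
open import Data.Sum using (_⊎_)
open import Function.Bundles using (_⇔_)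

lemma2 : {c ℓ : Level} (q : ℕ) (F : FiniteField c ℓ q)
    → (∃ λ p → ∃ λ k → Prime p × p ≢ 2 × k ≥ 1 × q ≡ p ^ k)
    → q % 4 ≡ 3
    → (a u u′ : FiniteField.Carrier F)
    → FiniteField.IsSquare F u → ¬ (FiniteField._≈_ F u (FiniteField.0# F))
    → FiniteField.IsSquare F u′ → ¬ (FiniteField._≈_ F u′ (FiniteField.0# F))
    → FiniteField._≈_ F (FiniteField._+_ F u u′) (FiniteField._*_ F a a)
    → (r r′ : FiniteField.Carrier F)
    → FiniteField._≈_ F (FiniteField._*_ F r r) u
    → FiniteField._≈_ F (FiniteField._*_ F r′ r′) u′
    → (ε : ℤ) → (ε ≡ + 1 ⊎ ε ≡ -[1+ 0 ])
    → ((FiniteField.η F (FiniteField._+_ F a r) ≡ ε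
    × FiniteField.η F (FiniteField._-_ F a r) ≡ ε)
    ⇔ (FiniteField.η F (FiniteField._+_ F a r′) ≡ FiniteField.η F (FiniteField.two F) * ε
    × FiniteField.η F (FiniteField._-_ F a r′) ≡ FiniteField.η F (FiniteField.two F) * ε))
lemma2 q F _ q%4≡3 a u u′ _ u≉0 _ u′≉0 u+u′≈a² r r′ r²≈u r′²≈u′ ε _ = mk⇔
  (λ (η[a+r]≡ε , _) →
    let η[a+r′]≡2ε = ≡.trans swap (≡.cong (η two *_) η[a+r]≡ε)
    in  η[a+r′]≡2ε , ≡.trans (≡.sym (η-conjugate a²≈r′²+r² r≉0)) η[a+r′]≡2ε)
  (λ (η[a+r′]≡2ε , _) →
    let η[a+r]≡ε = ℤₚ.*-cancelˡ-≡ (η two) _ _ ⦃ η-nonzero two≉0 ⦄ (≡.trans (≡.sym swap) η[a+r′]≡2ε)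
    in  η[a+r]≡ε , ≡.trans (≡.sym (η-conjugate a²≈r²+r′² r′≉0)) η[a+r]≡ε)
  where
  open FiniteField F using (_≈_; _+_; 0#; two; η; sym; trans; +-cong; +-comm) renaming (_*_ to _*ᶠ_)
  open FieldProperties (FiniteField.commRing F) (FiniteField.isField F) using (root-nonzero)
  open FiniteFieldProperties F using (odd-order⇒two≉0; η-nonzero; η-conjugate; η-swap)

  two≉0 : ¬ two ≈ 0#
  two≉0 = odd-order⇒two≉0 (≡.trans (≡.sym (m∣n⇒o%n%m≡o%m 2 4 q (divides 2 ≡.refl))) (≡.cong (_% 2) q%4≡3))

  a²≈r²+r′² : a *ᶠ a ≈ r *ᶠ r + r′ *ᶠ r′
  a²≈r²+r′² = sym (trans (+-cong r²≈u r′²≈u′) u+u′≈a²)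
  a²≈r′²+r² : a *ᶠ a ≈ r′ *ᶠ r′ + r *ᶠ r
  a²≈r′²+r² = trans a²≈r²+r′² (+-comm _ _)
  r≉0 : ¬ r ≈ 0#
  r≉0 = root-nonzero r²≈u u≉0
  r′≉0 : ¬ r′ ≈ 0#
  r′≉0 = root-nonzero r′²≈u′ u′≉0

  swap : η (a + r′) ≡ η two * η (a + r)
  swap = η-swap a²≈r²+r′² two≉0 r≉0 r′≉0
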